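{- Let $\alpha$ be a non-degenerate $(s+2t)$-simplex with vertices among the vertices of $\Pi^*_{s,t}$, let $\sigma$ be an exterior $k$-face of $\alpha$, let $\mathbf v$ be any vertex of $\sigma$, and let $\pi_\sigma$ be the projection defined below. Then $\pi_\sigma$ is one-to-one on the set of vertices of $\alpha$ that are not in $\sigma$.
   Context: $\Pi^*_{s,t}$ is the product of $s$ copies of $\Delta^1$ and $t$ copies of $\Delta^2$ ($\Delta^d$ the $d$-simplex, convex hull of the standard unit vectors of $\mathbb{R}^{d+1}$), written in standard coordinates with one block per factor; vertices are the $0/1$ points. Reduced coordinates with respect to a vertex $\mathbf v$ are obtained by deleting, in each factor, the coordinate where $\mathbf v$ is $1$, giving points of $\mathbb{R}^{s+2t}$. The class of the simplex is $|\det[\mathbf 1\mid M_{\mathbf v}]|$ with rows of $M_{\mathbf v}$ the reduced coordinates of its vertices; non-degenerate means class $\ne 0$. An exterior $k$-face of $\alpha$ is a $k$-face of $\alpha$ whose $k+1$ vertices lie in a common $k$-dimensional face of $\Pi^*_{s,t}$; then exactly $s+2t-k$ reduced coordinates (w.r.t. $\mathbf v$) vanish at all vertices of $\sigma$; call this set of coordinates $Z$. The map $\pi_\sigma:\mathbb{R}^{s+2t}\to\mathbb{R}^{s+2t}$ (in reduced coordinates w.r.t. $\mathbf v$) is the linear projection that keeps the coordinates in $Z$ and sets all other coordinates to $0$; it sends every vertex of $\sigma$ to the origin. -}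

module Defs where

open import Data.Nat as ℕ using (ℕ; zero; suc)
open import Data.Integer as ℤ using (ℤ; +_; -_)
open import Data.Fin as Fin using (Fin; zero; suc; punchIn; splitAt; remQuot)
open import Data.Fin.Subset using (Subset; _∈_; _∉_; ∣_∣)
open import Data.Bool using (Bool; true; false; if_then_else_; _∧_)
open import Data.Sum using (inj₁; inj₂)
open import Data.Product using (_×_; _,_; proj₁; proj₂; Σ; ∃)
open import Data.List.Base using (List; map; allFin; foldr)
open import Data.Nat.ListAction using (sum)
open import Data.Vec using (lookup)
open import Relation.Nullary using (does; ¬_)
open import Relation.Binary.PropositionalEquality using (_≡_)

-- Vertices of Π*_{s,t} = (Δ^1)^s × (Δ^2)^t : in each Δ^1 factor the
-- position (Fin 2) of the coordinate equal to 1, in each Δ^2 factor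
-- the position (Fin 3) of the coordinate equal to 1.
Vertex : ℕ → ℕ → Set
Vertex s t = (Fin s → Fin 2) × (Fin t → Fin 3)

_≋_ : ∀ {s t} → Vertex s t → Vertex s t → Set
_≋_ {s} {t} w u = (∀ j → proj₁ w j ≡ proj₁ u j) × (∀ j → proj₂ w j ≡ proj₂ u j)

dim : ℕ → ℕ → ℕ
dim s t = s ℕ.+ 2 ℕ.* t

indicator : ∀ {m} → Fin m → Fin m → ℤ
indicator a b = if does (a Fin.≟ b) then + 1 else + 0

-- In a factor where v has its 1 at position c, the remaining coordinates
-- (in their original order) are  punchIn c r  for r ranging over Fin 1
-- (Δ^1 factor) or Fin 2 (Δ^2 factor).  The s+2t reduced coordinates are
-- indexed by Fin (s + 2 * t): first the s Δ^1-factors, then the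
-- 2t coordinates of the Δ^2-factors (via remQuot).
reduced : ∀ {s t} → Vertex s t → Vertex s t → Fin (dim s t) → ℤ
reduced {s} {t} v w c with splitAt s c
... | inj₁ j = indicator (proj₁ w j) (punchIn (proj₁ v j) zero)
... | inj₂ d with remQuot {2} t d
...   | (r , j) = indicator (proj₂ w j) (punchIn (proj₂ v j) r)

Matrix : ℕ → Set
Matrix n = Fin n → Fin n → ℤ

sumFin : ∀ n → (Fin n → ℤ) → ℤ
sumFin zero f = + 0
sumFin (suc n) f = f zero ℤ.+ sumFin n (λ i → f (suc i))

altSign : ℕ → ℤ
altSign zero = + 1
altSign (suc m) = - altSign m

det : ∀ n → Matrix n → ℤ
det zero M = + 1
det (suc n) M =
  sumFin (suc n) (λ i → sign i ℤ.* (M i zero ℤ.* det n (λ a b → M (punchIn i a) (suc b))))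
  where
  sign : Fin (suc n) → ℤ
  sign i = altSign (Fin.toℕ i)

Simplex : ℕ → ℕ → Set
Simplex s t = Fin (suc (dim s t)) → Vertex s t

-- The matrix [1 | M_v], rows = vertices of α, first column all ones.
classMatrix : ∀ {s t} → Simplex s t → Vertex s t → Matrix (suc (dim s t))
classMatrix α v i zero = + 1
classMatrix α v i (suc c) = reduced v (α i) c

class : ∀ {s t} → Simplex s t → Vertex s t → ℕ
class {s} {t} α v = ℤ.∣ det (suc (dim s t)) (classMatrix α v) ∣

NonDegenerate : ∀ {s t} → Simplex s t → Vertex s t → Set
NonDegenerate α v = ¬ (class α v ≡ 0)

-- Faces of Π*_{s,t}: products of faces of the factors, i.e. a nonempty
-- subset of the coordinates of each factor; dimension Σ (|S_j| - 1).
record Face (s t : ℕ) : Set where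
  field
    S₁ : Fin s → Subset 2
    S₂ : Fin t → Subset 3
    S₁-nonempty : ∀ j → ¬ (∣ S₁ j ∣ ≡ 0)
    S₂-nonempty : ∀ j → ¬ (∣ S₂ j ∣ ≡ 0)

faceDim : ∀ {s t} → Face s t → ℕ
faceDim {s} {t} F =
  sum (map (λ j → ∣ Face.S₁ F j ∣ ℕ.∸ 1) (allFin s)) ℕ.+
  sum (map (λ j → ∣ Face.S₂ F j ∣ ℕ.∸ 1) (allFin t))

_∈Face_ : ∀ {s t} → Vertex s t → Face s t → Set
w ∈Face F = (∀ j → proj₁ w j ∈ Face.S₁ F j) × (∀ j → proj₂ w j ∈ Face.S₂ F j)

-- σ ⊆ vertex indices of α is a k-face of α (k+1 vertices)
-- and it is exterior: its vertices lie in a common k-dim face of Π*_{s,t}.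
ExteriorFace : ∀ {s t} → Simplex s t → ℕ → Subset (suc (dim s t)) → Set
ExteriorFace {s} {t} α k σ =
  (∣ σ ∣ ≡ suc k) ×
  Σ (Face s t) (λ F → (faceDim F ≡ k) × (∀ i → i ∈ σ → α i ∈Face F))

inZ : ∀ {s t} → Simplex s t → Subset (suc (dim s t)) → Vertex s t → Fin (dim s t) → Bool
inZ {s} {t} α σ v c =
  foldr (λ i b → b ∧ ( if lookup σ i then does (reduced v (α i) c ℤ.≟ + 0) else true))
      true (allFin (suc (dim s t)))

πσ : ∀ {s t} → Simplex s t → Subset (suc (dim s t)) → Vertex s t →
     (Fin (dim s t) → ℤ) → (Fin (dim s t) → ℤ)
πσ α σ v x c = if inZ α σ v c then x c else + 0

module Submission where

-- Suppose i ≠ j lie outside σ and π_σ sends their reduced coordinates to the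
-- same point.  Write the class matrix M = [1 | M_v] with row i split as
-- (row i − row j) + row j.  By linearity of det in row i, det M is the sum of
-- the determinant with two equal rows (which is 0) and the determinant D of
-- the matrix whose row i is row i − row j.  In the latter, the k + 2 rows of
-- σ ∪ {i} vanish at every coordinate of Z, hence are supported on the column
-- of ones and the coordinates outside Z.  Those are at most k: each one is a
-- free coordinate of the k-dimensional face of Π*_{s,t} containing σ, and a
-- face has exactly as many free coordinates as its dimension.  Fewer
-- supporting columns than rows force D = 0.  So the class is 0, contradicting
-- non-degeneracy; hence i = j.

open import Defs
open import Data.Nat using (ℕ)
open import Data.Fin using (Fin)
open import Data.Fin.Subset using (Subset; _∈_; _∉_)
open import Relation.Binary.PropositionalEquality using (_≡_)

open import Data.Nat as Nat using (zero; suc; _≤_; _<_; _∸_; z≤n; s≤s)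
import Data.Nat.Properties as ℕP
open import Data.Integer as ℤ using (ℤ; +_; -_; _+_; _*_; _-_)
import Data.Integer.Properties as ℤP
open import Data.Fin as Fin using (zero; suc; punchIn; punchOut; toℕ; inject₁; splitAt; remQuot; _↑ˡ_; _↑ʳ_)
import Data.Fin.Properties as FinP
open import Data.Fin.Subset using (∣_∣)
open import Data.Product using (_×_; _,_; proj₁; proj₂; Σ)
open import Data.Sum using (_⊎_; inj₁; inj₂)
open import Data.Empty using (⊥-elim)
open import Function using (_∘_; const; id)
open import Data.Bool using (Bool; true; false; _∧_; _∨_; not; if_then_else_)
open import Data.Bool.Properties using (∧-conicalˡ; ∧-conicalʳ; ∨-zeroʳ; ∨-identityʳ; not-injective)
open import Relation.Nullary using (Dec; yes; no; does)
open import Relation.Nullary.Decidable using (dec-true; dec-false)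
open import Relation.Binary.PropositionalEquality
  using (_≢_; _≗_; refl; sym; trans; cong; cong₂; cong-app; subst; module ≡-Reasoning)
open import Relation.Binary.Definitions using (tri<; tri≈; tri>)
open import Data.Vec using ([]; _∷_; lookup)
import Data.Vec.Properties as VecP
open import Data.Vec.Functional using (updateAt)
open import Data.Vec.Functional.Properties using (updateAt-updates; updateAt-minimal; updateAt-commutes; updateAt-id-local)
open import Data.List.Base using ([]; _∷_; map; allFin; tabulate; foldr)
import Data.List.Properties as ListP
open import Data.List.Membership.Propositional using () renaming (_∈_ to _∈L_)
open import Data.List.Membership.Propositional.Properties using (∈-allFin)
open import Data.List.Relation.Unary.Any using (here; there)
open import Data.Nat.ListAction using (sum)
open import Algebra.Properties.CommutativeSemigroup ℤP.+-commutativeSemigroup using (interchange; x∙yz≈y∙xz)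
import Algebra.Properties.AbelianGroup ℤP.+-0-abelianGroup as GroupP
import Algebra.Properties.CommutativeMonoid.Sum as MonoidSum

sumFin-cong : ∀ n {f g : Fin n → ℤ} → f ≗ g → sumFin n f ≡ sumFin n g
sumFin-cong zero    f≗g = refl
sumFin-cong (suc n) f≗g = cong₂ _+_ (f≗g zero) (sumFin-cong n (f≗g ∘ suc))

sumFin-zero : ∀ n (f : Fin n → ℤ) → (∀ i → f i ≡ + 0) → sumFin n f ≡ + 0
sumFin-zero zero    f f≡0 = refl
sumFin-zero (suc n) f f≡0 = cong₂ _+_ (f≡0 zero) (sumFin-zero n (f ∘ suc) (f≡0 ∘ suc))

sumFin-+ : ∀ n (f g : Fin n → ℤ) → sumFin n (λ i → f i + g i) ≡ sumFin n f + sumFin n g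
sumFin-+ zero    f g = refl
sumFin-+ (suc n) f g = trans (cong (λ x → f zero + g zero + x) (sumFin-+ n (f ∘ suc) (g ∘ suc)))
  (interchange (f zero) (g zero) (sumFin n (f ∘ suc)) (sumFin n (g ∘ suc)))

sumFin-remove : ∀ n (f : Fin (suc n) → ℤ) q → sumFin (suc n) f ≡ f q + sumFin n (f ∘ punchIn q)
sumFin-remove n       f zero    = refl
sumFin-remove (suc n) f (suc q) = trans (cong (λ x → f zero + x) (sumFin-remove n (f ∘ suc) q))
  (x∙yz≈y∙xz (f zero) (f (suc q)) (sumFin n (f ∘ suc ∘ punchIn q)))

punchIn-avoids : ∀ {n} {l q : Fin (suc n)} (l≢q : l ≢ q) (a : Fin n) → a ≢ punchOut l≢q → punchIn l a ≢ q
punchIn-avoids {l = l} l≢q a a≢ e = a≢ (FinP.punchIn-injective l a _ (trans e (sym (FinP.punchIn-punchOut l≢q))))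

sumFin-pair : ∀ n (f : Fin n → ℤ) q₁ q₂ → q₁ ≢ q₂ → (∀ a → a ≢ q₁ → a ≢ q₂ → f a ≡ + 0) →
              sumFin n f ≡ f q₁ + f q₂
sumFin-pair (suc zero) f zero zero 0≢0 _ = ⊥-elim (0≢0 refl)
sumFin-pair (suc (suc n)) f q₁ q₂ q₁≢q₂ f≡0 = begin
    sumFin (suc (suc n)) f                             ≡⟨ sumFin-remove (suc n) f q₁ ⟩
    f q₁ + sumFin (suc n) (f ∘ punchIn q₁)             ≡⟨ cong (λ x → f q₁ + x) (sumFin-remove n (f ∘ punchIn q₁) p) ⟩
    f q₁ + (f q₂′ + sumFin n (f ∘ punchIn q₁ ∘ punchIn p)) ≡⟨ cong₂ (λ x y → f q₁ + (f x + y)) (FinP.punchIn-punchOut q₁≢q₂) rest≡0 ⟩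
    f q₁ + (f q₂ + + 0)                                ≡⟨ cong (λ x → f q₁ + x) (ℤP.+-identityʳ (f q₂)) ⟩
    f q₁ + f q₂                                        ∎
  where
  open ≡-Reasoning
  p = punchOut q₁≢q₂
  q₂′ = punchIn q₁ p
  rest≡0 : sumFin n (f ∘ punchIn q₁ ∘ punchIn p) ≡ + 0
  rest≡0 = sumFin-zero n _ λ a →
    f≡0 _ (FinP.punchInᵢ≢i q₁ (punchIn p a)) (punchIn-avoids q₁≢q₂ (punchIn p a) (FinP.punchInᵢ≢i p a))

module ℕΣ = MonoidSum ℕP.+-0-commutativeMonoid

bit : Bool → ℕ
bit true  = 1
bit false = 0

count : ∀ n → (Fin n → Bool) → ℕ
count n f = ℕΣ.sum {n} (bit ∘ f)

count-remove : ∀ n (f : Fin (suc n) → Bool) q → count (suc n) f ≡ bit (f q) Nat.+ count n (f ∘ punchIn q)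
count-remove n f q = ℕΣ.sum-remove {i = q} (bit ∘ f)

∑-mono : ∀ n {f g : Fin n → ℕ} → (∀ i → f i ≤ g i) → ℕΣ.sum f ≤ ℕΣ.sum g
∑-mono zero    f≤g = z≤n
∑-mono (suc n) f≤g = ℕP.+-mono-≤ (f≤g zero) (∑-mono n (f≤g ∘ suc))

count-mono : ∀ n {f g : Fin n → Bool} → (∀ c → f c ≡ true → g c ≡ true) → count n f ≤ count n g
count-mono n f⇒g = ∑-mono n (λ c → bit-mono (f⇒g c))
  where
  bit-mono : ∀ {a b} → (a ≡ true → b ≡ true) → bit a ≤ bit b
  bit-mono {false} _   = z≤n
  bit-mono {true}  a⇒b rewrite a⇒b refl = ℕP.≤-refl

count-lookup : ∀ {n} (σ : Subset n) → count n (lookup σ) ≡ ∣ σ ∣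
count-lookup []          = refl
count-lookup (true ∷ σ)  = cong suc (count-lookup σ)
count-lookup (false ∷ σ) = count-lookup σ

count-others : ∀ m (S : Subset (suc m)) x → x ∈ S → count m (lookup S ∘ punchIn x) ≡ ∣ S ∣ ∸ 1
count-others m S x x∈S = cong (_∸ 1) (begin
    suc (count m (lookup S ∘ punchIn x))                   ≡⟨ cong (λ b → bit b Nat.+ count m (lookup S ∘ punchIn x))
                                                                 (sym (VecP.[]=⇒lookup x∈S)) ⟩
    bit (lookup S x) Nat.+ count m (lookup S ∘ punchIn x) ≡⟨ sym (count-remove m (lookup S) x) ⟩
    count (suc m) (lookup S)                               ≡⟨ count-lookup S ⟩
    ∣ S ∣                                                  ∎)
  where open ≡-Reasoning

∑-↑ : ∀ m n (f : Fin (m Nat.+ n) → ℕ) → ℕΣ.sum f ≡ ℕΣ.sum (f ∘ (_↑ˡ n)) Nat.+ ℕΣ.sum (f ∘ (m ↑ʳ_))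
∑-↑ zero    n f = refl
∑-↑ (suc m) n f = trans (cong (f zero Nat.+_) (∑-↑ m n (f ∘ suc))) (sym (ℕP.+-assoc (f zero) _ _))

∑-remQuot₂ : ∀ t (g : Fin 2 × Fin t → ℕ) →
  ℕΣ.sum (g ∘ remQuot {2} t) ≡ ℕΣ.sum (λ j → g (zero , j) Nat.+ g (suc zero , j))
∑-remQuot₂ t g = begin
    ℕΣ.sum h                                                            ≡⟨ ∑-↑ t (t Nat.+ 0) h ⟩
    ℕΣ.sum (λ (j : Fin t) → h (j ↑ˡ (t Nat.+ 0))) Nat.+ ℕΣ.sum (h ∘ (t ↑ʳ_))
      ≡⟨ cong₂ Nat._+_ (ℕΣ.sum-cong-≗ (λ j → cong g (FinP.remQuot-combine {2} {t} zero j)))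
                       (trans (∑-↑ t 0 (h ∘ (t ↑ʳ_))) (ℕP.+-identityʳ _)) ⟩
    ℕΣ.sum g₀ Nat.+ ℕΣ.sum (λ (j : Fin t) → h (t ↑ʳ (j ↑ˡ 0)))
      ≡⟨ cong (ℕΣ.sum g₀ Nat.+_) (ℕΣ.sum-cong-≗ (λ j → cong g (FinP.remQuot-combine {2} {t} (suc zero) j))) ⟩
    ℕΣ.sum g₀ Nat.+ ℕΣ.sum g₁                                          ≡⟨ sym (ℕΣ.∑-distrib-+ g₀ g₁) ⟩
    ℕΣ.sum (λ j → g₀ j Nat.+ g₁ j)                                     ∎
  where
  open ≡-Reasoning
  h : Fin (2 Nat.* t) → ℕ
  h = g ∘ remQuot {2} t
  g₀ g₁ : Fin t → ℕ
  g₀ j = g (zero , j)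
  g₁ j = g (suc zero , j)

listSum-allFin : ∀ n (f : Fin n → ℕ) → sum (map f (allFin n)) ≡ ℕΣ.sum f
listSum-allFin n f = trans (cong sum (ListP.map-tabulate id f)) (listSum-tabulate n f)
  where
  listSum-tabulate : ∀ n (f : Fin n → ℕ) → sum (tabulate f) ≡ ℕΣ.sum f
  listSum-tabulate zero    f = refl
  listSum-tabulate (suc n) f = cong (f zero Nat.+_) (listSum-tabulate n (f ∘ suc))

minor : ∀ {n} → Matrix (suc n) → Fin (suc n) → Matrix n
minor M i a b = M (punchIn i a) (suc b)

term : ∀ n → Matrix (suc n) → Fin (suc n) → ℤ
term n M i = altSign (toℕ i) * (M i zero * det n (minor M i))

term-minor-zero : ∀ n M l → det n (minor M l) ≡ + 0 → term n M l ≡ + 0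
term-minor-zero n M l d≡0 rewrite d≡0 | ℤP.*-zeroʳ (M l zero) = ℤP.*-zeroʳ (altSign (toℕ l))

term-entry-zero : ∀ n M l → M l zero ≡ + 0 → term n M l ≡ + 0
term-entry-zero n M l e≡0 rewrite e≡0 = ℤP.*-zeroʳ (altSign (toℕ l))

det-cong : ∀ n {M N : Matrix n} → (∀ a b → M a b ≡ N a b) → det n M ≡ det n N
det-cong zero    M≡N = refl
det-cong (suc n) M≡N = sumFin-cong (suc n) λ i →
  cong₂ (λ x d → altSign (toℕ i) * (x * d)) (M≡N i zero) (det-cong n (λ a b → M≡N (punchIn i a) (suc b)))

det-linear : ∀ n (M A B : Matrix n) (p : Fin n) →
  (∀ c → M p c ≡ A p c + B p c) →
  (∀ l → l ≢ p → ∀ c → M l c ≡ A l c) →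
  (∀ l → l ≢ p → ∀ c → M l c ≡ B l c) →
  det n M ≡ det n A + det n B
det-linear (suc n) M A B p Mp≡A+B M≡A M≡B =
  trans (sumFin-cong (suc n) termwise) (sumFin-+ (suc n) (term n A) (term n B))
  where
  open ≡-Reasoning
  termwise : ∀ l → term n M l ≡ term n A l + term n B l
  termwise l with l Fin.≟ p
  ... | yes refl = begin
      sg * (M l zero * det n (minor M l))     ≡⟨ cong₂ (λ x d → sg * (x * d)) (Mp≡A+B zero) minorM≡A ⟩
      sg * ((A l zero + B l zero) * dA)       ≡⟨ cong (sg *_) (ℤP.*-distribʳ-+ dA (A l zero) (B l zero)) ⟩
      sg * (A l zero * dA + B l zero * dA)    ≡⟨ ℤP.*-distribˡ-+ sg (A l zero * dA) (B l zero * dA) ⟩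
      sg * (A l zero * dA) + sg * (B l zero * dA) ≡⟨ cong (λ d → sg * (A l zero * dA) + sg * (B l zero * d)) minorA≡B ⟩
      term n A l + term n B l                 ∎
    where
    sg = altSign (toℕ l)
    dA = det n (minor A l)
    minorM≡A : det n (minor M l) ≡ dA
    minorM≡A = det-cong n λ a b → M≡A _ (FinP.punchInᵢ≢i l a) (suc b)
    minorA≡B : dA ≡ det n (minor B l)
    minorA≡B = det-cong n λ a b →
      trans (sym (M≡A _ (FinP.punchInᵢ≢i l a) (suc b))) (M≡B _ (FinP.punchInᵢ≢i l a) (suc b))
  ... | no l≢p = begin
      sg * (M l zero * det n (minor M l))     ≡⟨ cong (λ d → sg * (M l zero * d)) minor-linear ⟩
      sg * (M l zero * (dA + dB))             ≡⟨ cong (sg *_) (ℤP.*-distribˡ-+ (M l zero) dA dB) ⟩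
      sg * (M l zero * dA + M l zero * dB)    ≡⟨ ℤP.*-distribˡ-+ sg (M l zero * dA) (M l zero * dB) ⟩
      sg * (M l zero * dA) + sg * (M l zero * dB)
        ≡⟨ cong₂ (λ x y → sg * (x * dA) + sg * (y * dB)) (M≡A l l≢p zero) (M≡B l l≢p zero) ⟩
      term n A l + term n B l                 ∎
    where
    sg = altSign (toℕ l)
    dA = det n (minor A l)
    dB = det n (minor B l)
    p′ = punchOut l≢p
    minor-linear : det n (minor M l) ≡ dA + dB
    minor-linear = det-linear n (minor M l) (minor A l) (minor B l) p′
      (λ c → subst (λ r → M r (suc c) ≡ A r (suc c) + B r (suc c)) (sym (FinP.punchIn-punchOut l≢p)) (Mp≡A+B (suc c)))
      (λ a a≢ c → M≡A _ (punchIn-avoids l≢p a a≢) (suc c))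
      (λ a a≢ c → M≡B _ (punchIn-avoids l≢p a a≢) (suc c))

data Adjacent : ∀ {n} → Fin n → Fin n → Set where
  adjacent-zero : ∀ {n} → Adjacent {suc (suc n)} zero (suc zero)
  adjacent-suc  : ∀ {n} {a b : Fin n} → Adjacent a b → Adjacent (suc a) (suc b)

adjacent-toℕ : ∀ {n} {a b : Fin n} → Adjacent a b → toℕ b ≡ suc (toℕ a)
adjacent-toℕ adjacent-zero      = refl
adjacent-toℕ (adjacent-suc adj) = cong suc (adjacent-toℕ adj)

adjacent-≢ : ∀ {n} {a b : Fin n} → Adjacent a b → a ≢ b
adjacent-≢ (adjacent-suc adj) e = adjacent-≢ adj (FinP.suc-injective e)

inject₁-adjacent : ∀ {n} (j : Fin n) → Adjacent (inject₁ j) (suc j)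
inject₁-adjacent zero    = adjacent-zero
inject₁-adjacent (suc j) = adjacent-suc (inject₁-adjacent j)

adjacent-minor : ∀ {n} {q₁ q₂ : Fin (suc n)} (l : Fin (suc n)) → Adjacent q₁ q₂ → l ≢ q₁ → l ≢ q₂ →
  Σ (Fin n) λ a₁ → Σ (Fin n) λ a₂ → Adjacent a₁ a₂ × punchIn l a₁ ≡ q₁ × punchIn l a₂ ≡ q₂
adjacent-minor zero       adjacent-zero l≢q₁ _    = ⊥-elim (l≢q₁ refl)
adjacent-minor (suc zero) adjacent-zero _    l≢q₂ = ⊥-elim (l≢q₂ refl)
adjacent-minor {suc (suc n)} (suc (suc l)) adjacent-zero _ _ = zero , suc zero , adjacent-zero , refl , refl
adjacent-minor zero (adjacent-suc {a = a} {b} adj) _ _ = a , b , adj , refl , refl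
adjacent-minor {suc n} (suc l) (adjacent-suc adj) l≢q₁ l≢q₂
  with adjacent-minor l adj (l≢q₁ ∘ cong suc) (l≢q₂ ∘ cong suc)
... | a₁ , a₂ , adj′ , e₁ , e₂ = suc a₁ , suc a₂ , adjacent-suc adj′ , cong suc e₁ , cong suc e₂

adjacent-punchIn : ∀ {n} {q₁ q₂ : Fin (suc n)} → Adjacent q₁ q₂ → ∀ (a : Fin n) →
  (punchIn q₁ a ≡ punchIn q₂ a) ⊎ (punchIn q₁ a ≡ q₂ × punchIn q₂ a ≡ q₁)
adjacent-punchIn adjacent-zero      zero    = inj₂ (refl , refl)
adjacent-punchIn adjacent-zero      (suc a) = inj₁ refl
adjacent-punchIn (adjacent-suc adj) zero    = inj₁ refl
adjacent-punchIn (adjacent-suc adj) (suc a) with adjacent-punchIn adj a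
... | inj₁ e          = inj₁ (cong suc e)
... | inj₂ (e₁ , e₂) = inj₂ (cong suc e₁ , cong suc e₂)

-- A determinant with two equal adjacent rows vanishes: in the expansion the
-- terms of the two rows cancel and all other minors have equal adjacent rows.
det-adjacent-equal : ∀ n (M : Matrix n) {q₁ q₂ : Fin n} → Adjacent q₁ q₂ → M q₁ ≗ M q₂ → det n M ≡ + 0
det-adjacent-equal (suc n) M {q₁} {q₂} adj rows≡ =
  trans (sumFin-pair (suc n) (term n M) q₁ q₂ (adjacent-≢ adj) others) pair-cancels
  where
  open ≡-Reasoning
  others : ∀ l → l ≢ q₁ → l ≢ q₂ → term n M l ≡ + 0
  others l l≢q₁ l≢q₂ with adjacent-minor l adj l≢q₁ l≢q₂
  ... | a₁ , a₂ , adj′ , e₁ , e₂ = term-minor-zero n M l (det-adjacent-equal n (minor M l) adj′ λ c →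
        trans (cong (λ r → M r (suc c)) e₁) (trans (rows≡ (suc c)) (cong (λ r → M r (suc c)) (sym e₂))))
  minors-agree : det n (minor M q₁) ≡ det n (minor M q₂)
  minors-agree = det-cong n λ a b → agree a b (adjacent-punchIn adj a)
    where
    agree : ∀ a b → (punchIn q₁ a ≡ punchIn q₂ a) ⊎ (punchIn q₁ a ≡ q₂ × punchIn q₂ a ≡ q₁) →
            minor M q₁ a b ≡ minor M q₂ a b
    agree a b (inj₁ e)         = cong (λ r → M r (suc b)) e
    agree a b (inj₂ (e₁ , e₂)) = trans (cong (λ r → M r (suc b)) e₁)
      (trans (sym (rows≡ (suc b))) (cong (λ r → M r (suc b)) (sym e₂)))
  sg = altSign (toℕ q₁)
  X = M q₁ zero * det n (minor M q₁)
  pair-cancels : term n M q₁ + term n M q₂ ≡ + 0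
  pair-cancels = begin
    sg * X + term n M q₂   ≡⟨ cong (λ x → sg * X + x) (cong₂ (λ k y → altSign k * y) (adjacent-toℕ adj)
                                (cong₂ _*_ (sym (rows≡ zero)) (sym minors-agree))) ⟩
    sg * X + (- sg) * X    ≡⟨ cong (λ x → sg * X + x) (sym (ℤP.neg-distribˡ-* sg X)) ⟩
    sg * X + - (sg * X)    ≡⟨ ℤP.+-inverseʳ (sg * X) ⟩
    + 0                    ∎

_[_]≔_ : ∀ {n} → Matrix n → Fin n → (Fin n → ℤ) → Matrix n
M [ p ]≔ x = updateAt M p (const x)

[]≔-here : ∀ {n} (M : Matrix n) p x → (M [ p ]≔ x) p ≡ x
[]≔-here M p x = updateAt-updates p M

[]≔-other : ∀ {n} (M : Matrix n) {p l} x → l ≢ p → (M [ p ]≔ x) l ≡ M l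
[]≔-other M {p} {l} x l≢p = updateAt-minimal l p M l≢p

det-linear-row : ∀ n (M : Matrix n) p (x y : Fin n → ℤ) →
  det n (M [ p ]≔ (λ c → x c + y c)) ≡ det n (M [ p ]≔ x) + det n (M [ p ]≔ y)
det-linear-row n M p x y = det-linear n _ _ _ p
  (λ c → trans (cong-app ([]≔-here M p _) c)
                (sym (cong₂ _+_ (cong-app ([]≔-here M p x) c) (cong-app ([]≔-here M p y) c))))
  (λ l l≢p → cong-app (trans ([]≔-other M _ l≢p) (sym ([]≔-other M x l≢p))))
  (λ l l≢p → cong-app (trans ([]≔-other M _ l≢p) (sym ([]≔-other M y l≢p))))

-- With R x y the
-- matrix whose rows q₁, q₂ are x, y, bilinearity gives
-- 0 = det R(a+b)(a+b) = det R a a + det R a b + det R b a + det R b b,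
-- and the outer two terms vanish.
det-adjacent-swap : ∀ n (M : Matrix n) {q₁ q₂ : Fin n} → Adjacent q₁ q₂ →
  det n M + det n ((M [ q₁ ]≔ M q₂) [ q₂ ]≔ M q₁) ≡ + 0
det-adjacent-swap n M {q₁} {q₂} adj = sym (begin
    + 0                                                               ≡⟨ sym (R-equal a+b) ⟩
    det n (R a+b a+b)                                                 ≡⟨ linear-in-x a+b ⟩
    det n (R a a+b) + det n (R b a+b)                                 ≡⟨ cong₂ _+_ (linear-in-y a) (linear-in-y b) ⟩
    (det n (R a a) + det n (R a b)) + (det n (R b a) + det n (R b b)) ≡⟨ cong₂ (λ x y → x + (det n (R b a) + y))
                                                                          (cong₂ _+_ (R-equal a) R-id) (R-equal b) ⟩
    (+ 0 + det n M) + (det n (R b a) + + 0)                           ≡⟨ cong₂ _+_ (ℤP.+-identityˡ (det n M)) (ℤP.+-identityʳ (det n (R b a))) ⟩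
    det n M + det n (R b a)                                           ∎)
  where
  open ≡-Reasoning
  q₁≢q₂ = adjacent-≢ adj
  a = M q₁
  b = M q₂
  a+b = λ c → a c + b c
  R : (Fin n → ℤ) → (Fin n → ℤ) → Matrix n
  R x y = (M [ q₁ ]≔ x) [ q₂ ]≔ y
  R-equal : ∀ x → det n (R x x) ≡ + 0
  R-equal x = det-adjacent-equal n (R x x) adj
    (cong-app (trans (trans ([]≔-other _ x q₁≢q₂) ([]≔-here M q₁ x)) (sym ([]≔-here _ q₂ x))))
  R-id : det n (R a b) ≡ det n M
  R-id = det-cong n λ l → cong-app (trans (updateAt-id-local q₂ (M [ q₁ ]≔ a) (sym ([]≔-other M a (q₁≢q₂ ∘ sym))) l)
                 (updateAt-id-local q₁ M refl l))
  linear-in-y : ∀ x → det n (R x a+b) ≡ det n (R x a) + det n (R x b)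
  linear-in-y x = det-linear-row n (M [ q₁ ]≔ x) q₂ a b
  linear-in-x : ∀ y → det n (R a+b y) ≡ det n (R a y) + det n (R b y)
  linear-in-x y = trans (commute a+b) (trans (det-linear-row n (M [ q₂ ]≔ y) q₁ a b)
                                              (sym (cong₂ _+_ (commute a) (commute b))))
    where
    commute : ∀ x → det n (R x y) ≡ det n ((M [ q₂ ]≔ y) [ q₁ ]≔ x)
    commute x = det-cong n λ l → cong-app (updateAt-commutes q₂ q₁ (q₁≢q₂ ∘ sym) M l)

-- A determinant with rows i, j equal and i above j vanishes, by induction on
-- the position d of j: swapping j with the row just above it negates the
-- determinant and brings the two equal rows closer, until they are adjacent.
det-equal-rows-below : ∀ d n (M : Matrix n) (i j : Fin n) → toℕ j ≡ d → toℕ i < toℕ j →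
  M i ≗ M j → det n M ≡ + 0
det-equal-rows-below d       n       M i zero     _  ()   _
det-equal-rows-below zero    n       M i (suc j)  () _    _
det-equal-rows-below (suc d) (suc n) M i (suc j) j≡d i<j rows≡
  with ℕP.m≤n⇒m<n∨m≡n (Nat.s≤s⁻¹ i<j)
... | inj₂ i≡j = det-adjacent-equal (suc n) M (subst (λ r → Adjacent r (suc j)) (sym i≡j′) (inject₁-adjacent j)) rows≡
  where
  i≡j′ : i ≡ inject₁ j
  i≡j′ = FinP.toℕ-injective (trans i≡j (sym (FinP.toℕ-inject₁ j)))
... | inj₁ i<toℕj = begin
    det (suc n) M                       ≡⟨ sym (ℤP.+-identityʳ _) ⟩
    det (suc n) M + + 0                 ≡⟨ cong (λ x → det (suc n) M + x) (sym swapped≡0) ⟩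
    det (suc n) M + det (suc n) swapped ≡⟨ det-adjacent-swap (suc n) M (inject₁-adjacent j) ⟩
    + 0                                 ∎
  where
  open ≡-Reasoning
  j′ = inject₁ j
  swapped = (M [ j′ ]≔ M (suc j)) [ suc j ]≔ M j′
  i<j′ : toℕ i < toℕ j′
  i<j′ = subst (toℕ i <_) (sym (FinP.toℕ-inject₁ j)) i<toℕj
  i≢j′ : i ≢ j′
  i≢j′ e = ℕP.<-irrefl (cong toℕ e) i<j′
  i≢j : i ≢ suc j
  i≢j e = ℕP.<-irrefl (cong toℕ e) i<j
  swapped-rows : swapped i ≗ swapped j′
  swapped-rows c = begin
    swapped i c         ≡⟨ cong-app (trans ([]≔-other _ _ i≢j) ([]≔-other M _ i≢j′)) c ⟩
    M i c               ≡⟨ rows≡ c ⟩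
    M (suc j) c         ≡⟨ cong-app (sym ([]≔-here M j′ _)) c ⟩
    (M [ j′ ]≔ M (suc j)) j′ c ≡⟨ cong-app (sym ([]≔-other _ _ (adjacent-≢ (inject₁-adjacent j)))) c ⟩
    swapped j′ c        ∎
  swapped≡0 : det (suc n) swapped ≡ + 0
  swapped≡0 = det-equal-rows-below d (suc n) swapped i j′
    (trans (FinP.toℕ-inject₁ j) (ℕP.suc-injective j≡d)) i<j′ swapped-rows

det-equal-rows : ∀ n (M : Matrix n) (i j : Fin n) → i ≢ j → M i ≗ M j → det n M ≡ + 0
det-equal-rows n M i j i≢j rows≡ with ℕP.<-cmp (toℕ i) (toℕ j)
... | tri< i<j _ _ = det-equal-rows-below (toℕ j) n M i j refl i<j rows≡
... | tri≈ _ i≡j _ = ⊥-elim (i≢j (FinP.toℕ-injective i≡j))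
... | tri> _ _ j<i = det-equal-rows-below (toℕ i) n M j i refl j<i (sym ∘ rows≡)

-- In the
-- expansion along the first column each term either has a zero entry or a
-- minor satisfying the same hypothesis.
det-support : ∀ n (M : Matrix n) (R C : Fin n → Bool) →
  (∀ l c → R l ≡ true → C c ≡ false → M l c ≡ + 0) → count n C < count n R → det n M ≡ + 0
det-support zero    M R C vanish ()
det-support (suc n) M R C vanish C<R = sumFin-zero (suc n) (term n M) term≡0
  where
  term≡0 : ∀ l → term n M l ≡ + 0
  term≡0 l = by-cases (R l) (C zero) refl refl (subst (count (suc n) C <_) (count-remove n R l) C<R)
    where
    via-minor : count n (C ∘ suc) < count n (R ∘ punchIn l) → term n M l ≡ + 0
    via-minor fewer = term-minor-zero n M l
      (det-support n (minor M l) (R ∘ punchIn l) (C ∘ suc) (λ a b → vanish (punchIn l a) (suc b)) fewer)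
    by-cases : ∀ r c₀ → R l ≡ r → C zero ≡ c₀ →
      bit c₀ Nat.+ count n (C ∘ suc) < bit r Nat.+ count n (R ∘ punchIn l) → term n M l ≡ + 0
    by-cases true  false Rₗ C₀ _  = term-entry-zero n M l (vanish l zero Rₗ C₀)
    by-cases true  true  _  _  lt = via-minor (Nat.s<s⁻¹ lt)
    by-cases false true  _  _  lt = via-minor (ℕP.<-trans (ℕP.n<1+n _) lt)
    by-cases false false _  _  lt = via-minor lt

-- Free coordinates: for a vertex v and a face F of Π*_{s,t}, a reduced
-- coordinate (w.r.t. v) is free for F if the position of its factor that it
-- refers to is allowed by F.
module _ {s t : ℕ} (v : Vertex s t) (F : Face s t) where

  freeΔ¹ : Fin s → Fin 1 → Bool
  freeΔ¹ j r = lookup (Face.S₁ F j) (punchIn (proj₁ v j) r)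

  freeΔ² : Fin t → Fin 2 → Bool
  freeΔ² j r = lookup (Face.S₂ F j) (punchIn (proj₂ v j) r)

  freeAt : Fin s ⊎ Fin (2 Nat.* t) → Bool
  freeAt (inj₁ j) = freeΔ¹ j zero
  freeAt (inj₂ d) = let (r , j) = remQuot {2} t d in freeΔ² j r

  free : Fin (dim s t) → Bool
  free c = freeAt (splitAt s c)

indicator-outside : ∀ {m} (S : Subset m) a b → a ∈ S → lookup S b ≡ false → indicator a b ≡ + 0
indicator-outside S a b a∈S b∉S with a Fin.≟ b
... | no _     = refl
... | yes refl with () ← trans (sym (VecP.[]=⇒lookup a∈S)) b∉S

vanishes-off-free : ∀ {s t} (v w : Vertex s t) F c → w ∈Face F → free v F c ≡ false → reduced v w c ≡ + 0
vanishes-off-free {s} {t} v w F c (w∈S₁ , w∈S₂) not-free with splitAt s c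
... | inj₁ j = indicator-outside (Face.S₁ F j) _ _ (w∈S₁ j) not-free
... | inj₂ d = indicator-outside (Face.S₂ F (proj₂ (remQuot {2} t d))) _ _ (w∈S₂ _) not-free

free-count : ∀ {s t} (v : Vertex s t) F → v ∈Face F → count (dim s t) (free v F) ≡ faceDim F
free-count {s} {t} v F (v∈S₁ , v∈S₂) = begin
    count (dim s t) (free v F)
      ≡⟨ ∑-↑ s (2 Nat.* t) (bit ∘ free v F) ⟩
    ℕΣ.sum (λ (j : Fin s) → bit (free v F (j ↑ˡ (2 Nat.* t)))) Nat.+ ℕΣ.sum (bit ∘ free v F ∘ (s ↑ʳ_))
      ≡⟨ cong₂ Nat._+_ (ℕΣ.sum-cong-≗ λ j → cong (bit ∘ freeAt v F) (FinP.splitAt-↑ˡ s j (2 Nat.* t)))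
                       (ℕΣ.sum-cong-≗ λ d → cong (bit ∘ freeAt v F) (FinP.splitAt-↑ʳ s (2 Nat.* t) d)) ⟩
    ℕΣ.sum (λ j → bit (freeΔ¹ v F j zero)) Nat.+ ℕΣ.sum (λ d → bit (freeAt v F (inj₂ d)))
      ≡⟨ cong₂ Nat._+_ (ℕΣ.sum-cong-≗ λ j → sym (ℕP.+-identityʳ (bit (freeΔ¹ v F j zero))))
                       (trans (∑-remQuot₂ t λ (r , j) → bit (freeΔ² v F j r))
                              (ℕΣ.sum-cong-≗ λ j → cong (bit (freeΔ² v F j zero) Nat.+_) (sym (ℕP.+-identityʳ (bit (freeΔ² v F j (suc zero))))))) ⟩
    ℕΣ.sum (λ j → count 1 (freeΔ¹ v F j)) Nat.+ ℕΣ.sum (λ j → count 2 (freeΔ² v F j))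
      ≡⟨ cong₂ Nat._+_ (ℕΣ.sum-cong-≗ λ j → count-others 1 (Face.S₁ F j) (proj₁ v j) (v∈S₁ j))
                       (ℕΣ.sum-cong-≗ λ j → count-others 2 (Face.S₂ F j) (proj₂ v j) (v∈S₂ j)) ⟩
    ℕΣ.sum (λ j → ∣ Face.S₁ F j ∣ ∸ 1) Nat.+ ℕΣ.sum (λ j → ∣ Face.S₂ F j ∣ ∸ 1)
      ≡⟨ sym (cong₂ Nat._+_ (listSum-allFin s _) (listSum-allFin t _)) ⟩
    faceDim F ∎
  where open ≡-Reasoning

foldr-∧-sound : ∀ {A : Set} (g : A → Bool) xs → foldr (λ x b → b ∧ g x) true xs ≡ true →
  ∀ {x} → x ∈L xs → g x ≡ true
foldr-∧-sound g (y ∷ ys) all-true (here refl) = ∧-conicalʳ _ (g y) all-true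
foldr-∧-sound g (y ∷ ys) all-true (there x∈ys) = foldr-∧-sound g ys (∧-conicalˡ _ (g y) all-true) x∈ys

foldr-∧-complete : ∀ {A : Set} (g : A → Bool) xs → (∀ x → g x ≡ true) → foldr (λ x b → b ∧ g x) true xs ≡ true
foldr-∧-complete g []       _     = refl
foldr-∧-complete g (y ∷ ys) g-true rewrite foldr-∧-complete g ys g-true | g-true y = refl

does-true : ∀ {P : Set} (P? : Dec P) → does P? ≡ true → P
does-true (yes p) _  = p
does-true (no _)  ()

inZ-sound : ∀ {s t} (α : Simplex s t) σ v c → inZ α σ v c ≡ true → ∀ l → l ∈ σ → reduced v (α l) c ≡ + 0
inZ-sound α σ v c c∈Z l l∈σ = does-true (reduced v (α l) c ℤ.≟ + 0)
  (subst (λ b → (if b then does (reduced v (α l) c ℤ.≟ + 0) else true) ≡ true) (VecP.[]=⇒lookup l∈σ)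
         (foldr-∧-sound _ (allFin _) c∈Z (∈-allFin l)))

inZ-complete : ∀ {s t} (α : Simplex s t) σ v c → (∀ l → l ∈ σ → reduced v (α l) c ≡ + 0) → inZ α σ v c ≡ true
inZ-complete α σ v c vanish = foldr-∧-complete _ (allFin _) vanishes-at
  where
  vanishes-at : ∀ l → (if lookup σ l then does (reduced v (α l) c ℤ.≟ + 0) else true) ≡ true
  vanishes-at l with lookup σ l in l∈σ
  ... | true  = dec-true (reduced v (α l) c ℤ.≟ + 0) (vanish l (VecP.lookup⇒[]= l σ l∈σ))
  ... | false = refl

πσ-on-Z : ∀ {s t} (α : Simplex s t) σ v x c → inZ α σ v c ≡ true → πσ α σ v x c ≡ x c
πσ-on-Z α σ v x c c∈Z rewrite c∈Z = refl

lookup-∉ : ∀ {n} (σ : Subset n) i → i ∉ σ → lookup σ i ≡ false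
lookup-∉ σ i i∉σ with lookup σ i in i∈?σ
... | true  = ⊥-elim (i∉σ (VecP.lookup⇒[]= i σ i∈?σ))
... | false = refl

_with-row_ : ∀ {n} → Subset n → Fin n → Fin n → Bool
(σ with-row i) l = lookup σ l ∨ does (l Fin.≟ i)

count-with-row : ∀ n (σ : Subset (suc n)) i → i ∉ σ → count (suc n) (σ with-row i) ≡ suc ∣ σ ∣
count-with-row n σ i i∉σ = begin
    count (suc n) (σ with-row i)                                   ≡⟨ count-remove n (σ with-row i) i ⟩
    bit ((σ with-row i) i) Nat.+ count n ((σ with-row i) ∘ punchIn i)
      ≡⟨ cong₂ (λ b m → bit b Nat.+ m)
               (trans (cong (lookup σ i ∨_) (dec-true (i Fin.≟ i) refl)) (∨-zeroʳ _))
               (ℕΣ.sum-cong-≗ λ a → cong bit (trans (cong (lookup σ (punchIn i a) ∨_)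
                   (dec-false (punchIn i a Fin.≟ i) (FinP.punchInᵢ≢i i a))) (∨-identityʳ _))) ⟩
    suc (count n (lookup σ ∘ punchIn i))                           ≡⟨ cong (λ b → suc (bit b Nat.+ count n (lookup σ ∘ punchIn i)))
                                                                        (sym (lookup-∉ σ i i∉σ)) ⟩
    suc (bit (lookup σ i) Nat.+ count n (lookup σ ∘ punchIn i))   ≡⟨ cong suc (sym (count-remove n (lookup σ) i)) ⟩
    suc (count (suc n) (lookup σ))                                 ≡⟨ cong suc (count-lookup σ) ⟩
    suc ∣ σ ∣                                                      ∎
  where open ≡-Reasoning

-- Outside Z there are at most k coordinates: they are all free for the
-- k-dimensional face F of Π*_{s,t} containing σ, since every vertex of F
-- vanishes at the non-free coordinates.
count-outside-Z : ∀ {s t} (α : Simplex s t) k σ i₀ → ExteriorFace α k σ → i₀ ∈ σ →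
  count (dim s t) (not ∘ inZ α σ (α i₀)) ≤ k
count-outside-Z {s} {t} α k σ i₀ (_ , F , dimF≡k , σ⊆F) i₀∈σ = begin
    count (dim s t) (not ∘ inZ α σ v)  ≤⟨ count-mono (dim s t) outside-Z-free ⟩
    count (dim s t) (free v F)         ≡⟨ free-count v F (σ⊆F i₀ i₀∈σ) ⟩
    faceDim F                          ≡⟨ dimF≡k ⟩
    k                                  ∎
  where
  open ℕP.≤-Reasoning
  v = α i₀
  outside-Z-free : ∀ c → not (inZ α σ v c) ≡ true → free v F c ≡ true
  outside-Z-free c c∉Z with free v F c in free?
  ... | true  = refl
  ... | false with () ← trans (sym c∉Z) (cong not (inZ-complete α σ v c λ l l∈σ →
                           vanishes-off-free v (α l) F c (σ⊆F l l∈σ) free?))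

-- Splitting row i of M = [1 | M_v] as
-- (row i − row j) + row j, the second summand has two equal rows, and in the
-- first the k + 2 rows σ ∪ {i} are supported on the column of ones and the
-- at most k coordinates outside Z.
class-det-vanishes : ∀ {s t} (α : Simplex s t) k σ i₀ → ExteriorFace α k σ → i₀ ∈ σ →
  ∀ i j → i ∉ σ → i ≢ j →
  (∀ c → πσ α σ (α i₀) (reduced (α i₀) (α i)) c ≡ πσ α σ (α i₀) (reduced (α i₀) (α j)) c) →
  det (suc (dim s t)) (classMatrix α (α i₀)) ≡ + 0
class-det-vanishes {s} {t} α k σ i₀ face i₀∈σ i j i∉σ i≢j same-image = begin
    det n M                                         ≡⟨ det-cong n split-row-i ⟩
    det n (M [ i ]≔ (λ c → difference c + M j c))  ≡⟨ det-linear-row n M i difference (M j) ⟩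
    det n (M [ i ]≔ difference) + det n (M [ i ]≔ M j) ≡⟨ cong₂ _+_ difference-det≡0 repeated-det≡0 ⟩
    + 0                                             ∎
  where
  open ≡-Reasoning
  n = suc (dim s t)
  v = α i₀
  M = classMatrix α v
  difference : Fin n → ℤ
  difference c = M i c - M j c

  split-row-i : ∀ l c → M l c ≡ (M [ i ]≔ (λ c → difference c + M j c)) l c
  split-row-i l c with l Fin.≟ i
  ... | yes refl = sym (trans (cong-app ([]≔-here M i _) c) (GroupP.//-rightDividesˡ (M j c) (M l c)))
  ... | no l≢i   = sym (cong-app ([]≔-other M _ l≢i) c)

  repeated-det≡0 : det n (M [ i ]≔ M j) ≡ + 0
  repeated-det≡0 = det-equal-rows n (M [ i ]≔ M j) i j i≢j
    (cong-app (trans ([]≔-here M i (M j)) (sym ([]≔-other M _ (i≢j ∘ sym)))))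

  support : Fin n → Bool
  support zero    = true
  support (suc c) = not (inZ α σ v c)

  vanishes-off-support : ∀ l c → (σ with-row i) l ≡ true → support c ≡ false → (M [ i ]≔ difference) l c ≡ + 0
  vanishes-off-support l zero    _     ()
  vanishes-off-support l (suc c) l∈σ+i c∉support with c∈Z ← not-injective c∉support | l Fin.≟ i
  ... | yes refl = trans (cong-app ([]≔-here M i difference) (suc c))
                         (ℤP.i≡j⇒i-j≡0 (trans (sym (πσ-on-Z α σ v (reduced v (α l)) c c∈Z))
                           (trans (same-image c) (πσ-on-Z α σ v (reduced v (α j)) c c∈Z))))
  ... | no l≢i   = trans (cong-app ([]≔-other M _ l≢i) (suc c)) (inZ-sound α σ v c c∈Z l
                     (VecP.lookup⇒[]= l σ (trans (sym (∨-identityʳ _)) l∈σ+i)))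

  fewer-columns : count n support < count n (σ with-row i)
  fewer-columns = Ord.begin-strict
    count n support                      Ord.≤⟨ s≤s (count-outside-Z α k σ i₀ face i₀∈σ) ⟩
    suc k                                Ord.<⟨ ℕP.n<1+n (suc k) ⟩
    suc (suc k)                          Ord.≡⟨ cong suc (sym (proj₁ face)) ⟩
    suc ∣ σ ∣                            Ord.≡⟨ sym (count-with-row (dim s t) σ i i∉σ) ⟩
    count n (σ with-row i)               Ord.∎
    where module Ord = ℕP.≤-Reasoning

  difference-det≡0 : det n (M [ i ]≔ difference) ≡ + 0
  difference-det≡0 = det-support n _ (σ with-row i) support vanishes-off-support fewer-columns

proposition8 : (s t : ℕ) (α : Simplex s t) (k : ℕ) (σ : Subset _) (i₀ : Fin _) →
    ExteriorFace α k σ → i₀ ∈ σ → NonDegenerate α (α i₀) →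
    ∀ i j → i ∉ σ → j ∉ σ →
    (∀ c → πσ α σ (α i₀) (reduced (α i₀) (α i)) c ≡ πσ α σ (α i₀) (reduced (α i₀) (α j)) c) →
    α i ≋ α j
proposition8 s t α k σ i₀ face i₀∈σ non-degenerate i j i∉σ _ same-image with i Fin.≟ j
... | yes refl = (λ _ → refl) , (λ _ → refl)
... | no i≢j   = ⊥-elim (non-degenerate (cong ℤ.∣_∣ (class-det-vanishes α k σ i₀ face i₀∈σ i j i∉σ i≢j same-image)))
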